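{- Let $T$ be a balanced binary tree, $t$ a node of $T$, $d$ a positive power of $2$, and $h$ the height of the subtree of $T$ rooted at $t$. Then the length of the sequence $\mathcal{L}(t,d)$ is $$2^{h}\,d\binom{h+\log d}{\log d}.$$
   Context: $\log$ is base 2. For integers $s\ge 0$ the universal sequence $\sigma_s$ (of length $2^{s+1}-1$) is defined by $\sigma_0=\langle 1\rangle$ and $\sigma_s=\sigma_{s-1}\diamond\langle 2^s\rangle\diamond\sigma_{s-1}$ for $s>0$, where $\diamond$ is concatenation. For a node $t$ of $T$ with left child $\mathrm{left}(t)$ and right child $\mathrm{right}(t)$ and $d$ a positive power of 2, the sequence of leaves $\mathcal{L}(t,d)$ is defined by $\mathcal{L}(t,d)=\mathcal{L}(\mathrm{left}(t),c_1)\diamond\mathcal{L}(\mathrm{right}(t),c_1)\diamond\mathcal{L}(\mathrm{left}(t),c_2)\diamond\mathcal{L}(\mathrm{right}(t),c_2)\diamond\cdots\diamond\mathcal{L}(\mathrm{left}(t),c_{2d-1})\diamond\mathcal{L}(\mathrm{right}(t),c_{2d-1})$, where $c_i$ is the $i$-th integer of $\sigma_{\log d}$; if $t$ is a leaf, $\mathcal{L}(t,d)$ is $\langle t\rangle$ concatenated with itself $d$ times. The length of $\mathcal{L}(t,d)$ is its number of entries. Here "balanced binary tree" is understood as a rooted binary tree in which every internal node has exactly two children and all leaves of each subtree are at the same depth. -}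

module Defs where

open import Data.Nat using (ℕ; zero; suc; _^_; _⊔_)
open import Data.Nat.Logarithm using (⌊log₂_⌋)
open import Data.List using (List; []; _∷_; _++_; map; replicate)
open import Data.Product using (∃)

data Tree : Set where
  leaf : Tree
  node : Tree → Tree → Tree

-- Nodes of a tree, given as positions (paths from the root).
data Pos : Tree → Set where
  here  : ∀ {t} → Pos t
  goL   : ∀ {l r} → Pos l → Pos (node l r)
  goR   : ∀ {l r} → Pos r → Pos (node l r)

subtree : (T : Tree) → Pos T → Tree
subtree T here = T
subtree (node l r) (goL p) = subtree l p
subtree (node l r) (goR p) = subtree r p

embed : (T : Tree) (p : Pos T) → Pos (subtree T p) → Pos T
embed T here q = q
embed (node l r) (goL p) q = goL (embed l p q)
embed (node l r) (goR p) q = goR (embed r p q)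

height : Tree → ℕ
height leaf = 0
height (node l r) = suc (height l ⊔ height r)

data Perfect : ℕ → Tree → Set where
  leafP : Perfect 0 leaf
  nodeP : ∀ {h l r} → Perfect h l → Perfect h r → Perfect (suc h) (node l r)

Balanced : Tree → Set
Balanced T = ∃ λ h → Perfect h T

σ : ℕ → List ℕ
σ zero = 1 ∷ []
σ (suc s) = σ s ++ ((2 ^ suc s) ∷ σ s)

mutual
  Lseq : (t : Tree) → ℕ → List (Pos t)
  Lseq leaf d = replicate d here
  Lseq (node l r) d = Lpairs l r (σ ⌊log₂ d ⌋)

  Lpairs : (l r : Tree) → List ℕ → List (Pos (node l r))
  Lpairs l r [] = []
  Lpairs l r (c ∷ cs) =
    map goL (Lseq l c) ++ (map goR (Lseq r c) ++ Lpairs l r cs)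

L : (T : Tree) → Pos T → ℕ → List (Pos T)
L T p d = map (embed T p) (Lseq (subtree T p) d)

module Submission where

open import Defs
open import Data.Nat using (ℕ; zero; suc; _+_; _*_; _^_)
open import Data.Nat.Properties using (+-identityʳ; +-suc; ⊔-idem)
open import Data.Nat.Combinatorics using (_C_; nCn≡1; nCk+nC[k+1]≡[n+1]C[k+1])
open import Data.Nat.Logarithm using (⌊log₂[2^n]⌋≡n)
open import Data.Nat.Tactic.RingSolver using (solve-∀)
open import Data.List using (List; []; _∷_; _++_; map; length)
open import Data.List.Properties using (length-map; length-replicate; length-++; map-++)
open import Data.Nat.ListAction using (sum)
open import Data.Nat.ListAction.Properties using (sum-++)
open import Data.Product using (_,_)
open import Function using (_∘_)
open import Relation.Binary.PropositionalEquality using (_≡_; refl; sym; trans; cong; cong₂; module ≡-Reasoning)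

-- For t = node l r we have |L(t, 2^k)| = Σ_{2^i ∈ σ_k} (|L(l, 2^i)| + |L(r, 2^i)|), and since
-- σ_{k+1} = σ_k ⋄ ⟨2^{k+1}⟩ ⋄ σ_k, a sum over σ_{k+1} is twice the sum over σ_k plus one
-- new term.  By Pascal's rule the closed form 2^h 2^k C(h+k, k) solves this recursion,
-- by induction on the height h and, inside, on k.

closedLength : ℕ → ℕ → ℕ
closedLength h k = 2 ^ h * 2 ^ k * ((h + k) C k)

height-Perfect : ∀ {h t} → Perfect h t → height t ≡ h
height-Perfect leafP = refl
height-Perfect (nodeP {h} pl pr) rewrite height-Perfect pl | height-Perfect pr | ⊔-idem h = refl

Balanced-subtree : ∀ {T} → Balanced T → (p : Pos T) → Balanced (subtree T p)
Balanced-subtree b here = b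
Balanced-subtree (_ , nodeP pl pr) (goL p) = Balanced-subtree (_ , pl) p
Balanced-subtree (_ , nodeP pl pr) (goR p) = Balanced-subtree (_ , pr) p

sum-map-σ-suc : ∀ (f : ℕ → ℕ) s →
  sum (map f (σ (suc s))) ≡ 2 * sum (map f (σ s)) + f (2 ^ suc s)
sum-map-σ-suc f s = begin
  sum (map f (σ s ++ (2 ^ suc s ∷ σ s)))         ≡⟨ cong sum (map-++ f (σ s) _) ⟩
  sum (map f (σ s) ++ map f (2 ^ suc s ∷ σ s))   ≡⟨ sum-++ (map f (σ s)) _ ⟩
  sum (map f (σ s)) + (f (2 ^ suc s) + sum (map f (σ s)))
                                                 ≡⟨ rearrange (sum (map f (σ s))) (f (2 ^ suc s)) ⟩
  2 * sum (map f (σ s)) + f (2 ^ suc s)          ∎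
  where
  open ≡-Reasoning
  rearrange : ∀ a b → a + (b + a) ≡ 2 * a + b
  rearrange = solve-∀

pascal-closedLength : ∀ h k →
  2 * (2 ^ h * 2 ^ k * ((suc h + k) C k)) + closedLength h (suc k)
    ≡ 2 ^ h * 2 ^ suc k * ((suc h + suc k) C suc k)
pascal-closedLength h k
  rewrite +-suc h k | sym (nCk+nC[k+1]≡[n+1]C[k+1] (suc h + k) k) =
  distribute (2 ^ h) (2 ^ k) ((suc h + k) C k) ((suc h + k) C suc k)
  where
  distribute : ∀ a b x y → 2 * (a * b * x) + a * (2 * b) * y ≡ a * (2 * b) * (x + y)
  distribute = solve-∀

sum-map-σ-closedLength : ∀ h (f : ℕ → ℕ) → (∀ i → f (2 ^ i) ≡ closedLength h i) →
  ∀ k → sum (map f (σ k)) ≡ 2 ^ h * 2 ^ k * ((suc h + k) C k)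
sum-map-σ-closedLength h f f≡ zero = trans (+-identityʳ (f 1)) (f≡ 0)
sum-map-σ-closedLength h f f≡ (suc k) = begin
  sum (map f (σ (suc k)))                                     ≡⟨ sum-map-σ-suc f k ⟩
  2 * sum (map f (σ k)) + f (2 ^ suc k)                       ≡⟨ cong₂ (λ a b → 2 * a + b)
                                                                   (sum-map-σ-closedLength h f f≡ k) (f≡ (suc k)) ⟩
  2 * (2 ^ h * 2 ^ k * ((suc h + k) C k)) + closedLength h (suc k) ≡⟨ pascal-closedLength h k ⟩
  2 ^ h * 2 ^ suc k * ((suc h + suc k) C suc k)               ∎
  where open ≡-Reasoning

length-Lpairs : ∀ l r (cs : List ℕ) →
  length (Lpairs l r cs) ≡ sum (map (length ∘ Lseq l) cs) + sum (map (length ∘ Lseq r) cs)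
length-Lpairs l r [] = refl
length-Lpairs l r (c ∷ cs) = begin
  length (map goL (Lseq l c) ++ (map goR (Lseq r c) ++ Lpairs l r cs))
    ≡⟨ length-++ (map goL (Lseq l c)) ⟩
  length (map goL (Lseq l c)) + length (map goR (Lseq r c) ++ Lpairs l r cs)
    ≡⟨ cong₂ _+_ (length-map goL (Lseq l c)) (length-++ (map goR (Lseq r c))) ⟩
  length (Lseq l c) + (length (map goR (Lseq r c)) + length (Lpairs l r cs))
    ≡⟨ cong₂ (λ b x → length (Lseq l c) + (b + x)) (length-map goR (Lseq r c)) (length-Lpairs l r cs) ⟩
  length (Lseq l c) + (length (Lseq r c) + (sum (map (length ∘ Lseq l) cs) + sum (map (length ∘ Lseq r) cs)))
    ≡⟨ interchange (length (Lseq l c)) (length (Lseq r c)) _ _ ⟩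
  (length (Lseq l c) + sum (map (length ∘ Lseq l) cs)) + (length (Lseq r c) + sum (map (length ∘ Lseq r) cs)) ∎
  where
  open ≡-Reasoning
  interchange : ∀ a b x y → a + (b + (x + y)) ≡ (a + x) + (b + y)
  interchange = solve-∀

length-Lseq-Perfect : ∀ {h t} → Perfect h t → ∀ k → length (Lseq t (2 ^ k)) ≡ closedLength h k
length-Lseq-Perfect leafP k rewrite nCn≡1 k = trans (length-replicate (2 ^ k)) (unit (2 ^ k))
  where
  unit : ∀ a → a ≡ 1 * a * 1
  unit = solve-∀
length-Lseq-Perfect {suc h} (nodeP {l = l} {r} pl pr) k rewrite ⌊log₂[2^n]⌋≡n k = begin
  length (Lpairs l r (σ k))                                          ≡⟨ length-Lpairs l r (σ k) ⟩
  sum (map (length ∘ Lseq l) (σ k)) + sum (map (length ∘ Lseq r) (σ k))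
    ≡⟨ cong₂ _+_ (sum-map-σ-closedLength h _ (length-Lseq-Perfect pl) k)
                 (sum-map-σ-closedLength h _ (length-Lseq-Perfect pr) k) ⟩
  2 ^ h * 2 ^ k * ((suc h + k) C k) + 2 ^ h * 2 ^ k * ((suc h + k) C k) ≡⟨ double (2 ^ h) (2 ^ k) _ ⟩
  closedLength (suc h) k                                             ∎
  where
  open ≡-Reasoning
  double : ∀ a b x → a * b * x + a * b * x ≡ 2 * a * b * x
  double = solve-∀

length-Lseq-Balanced : ∀ {t} → Balanced t → ∀ k → length (Lseq t (2 ^ k)) ≡ closedLength (height t) k
length-Lseq-Balanced (h , P) k rewrite height-Perfect P = length-Lseq-Perfect P k

lemma9 : (T : Tree) → Balanced T → (t : Pos T) → (k : ℕ) →
    length (L T t (2 ^ k))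
      ≡ 2 ^ height (subtree T t) * 2 ^ k * ((height (subtree T t) + k) C k)
lemma9 T b t k =
  trans (length-map (embed T t) (Lseq (subtree T t) (2 ^ k)))
        (length-Lseq-Balanced (Balanced-subtree b t) k)
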